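{- Let $G$ be a graph containing two edge-disjoint Hamilton paths $P_1$ and $P_2$, and consider an edge-coloring of $G$ in which every edge of $P_1$ is colored $1$ and every edge of $P_2$ is colored $2$. Then between any pair of distinct vertices of $G$ there exist: a path all of whose edges have color $1$; a path all of whose edges have color $2$; a conflict-free path in which color $1$ is used exactly once; and a conflict-free path in which color $2$ is used exactly once.
   Context: In an edge-colored graph, a path is conflict-free if there is at least one color that is used on exactly one of its edges. -}

module Defs where

open import Data.Nat using (ℕ; _≟_)
open import Data.Fin using (Fin)
open import Data.List using (List; []; _∷_; map; filter; length; head; last)
open import Data.List.Relation.Unary.All using (All)
open import Data.List.Relation.Unary.Unique.Propositional using (Unique)
open import Data.List.Membership.Propositional using (_∈_)
open import Data.Product using (_×_; _,_; ∃-syntax; uncurry)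
open import Data.Maybe using (Maybe; just)
open import Relation.Binary.PropositionalEquality using (_≡_)
open import Relation.Nullary using (¬_)

record Graph (n : ℕ) : Set₁ where
  field
    Adj    : Fin n → Fin n → Set
    sym    : ∀ {u v} → Adj u v → Adj v u
    irrefl : ∀ {u} → ¬ Adj u u
open Graph public

-- An edge colouring: a symmetric colour assignment to vertex pairs
-- (its values on non-adjacent pairs are irrelevant).
record EdgeColoring (n : ℕ) : Set where
  field
    col     : Fin n → Fin n → ℕ
    col-sym : ∀ u v → col u v ≡ col v u
open EdgeColoring public

edges : ∀ {n} → List (Fin n) → List (Fin n × Fin n)
edges []           = []
edges (x ∷ [])     = []
edges (x ∷ y ∷ xs) = (x , y) ∷ edges (y ∷ xs)

IsPath : ∀ {n} → Graph n → List (Fin n) → Set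
IsPath G xs = Unique xs × All (uncurry (Adj G)) (edges xs)

PathBetween : ∀ {n} → Graph n → Fin n → Fin n → List (Fin n) → Set
PathBetween G u v xs = IsPath G xs × head xs ≡ just u × last xs ≡ just v

HamiltonPath : ∀ {n} → Graph n → List (Fin n) → Set
HamiltonPath G xs = IsPath G xs × (∀ x → x ∈ xs)

EdgeDisjoint : ∀ {n} → List (Fin n) → List (Fin n) → Set
EdgeDisjoint P Q = ∀ a b → (a , b) ∈ edges P →
  ¬ ((a , b) ∈ edges Q) × ¬ ((b , a) ∈ edges Q)

ColoredOn : ∀ {n} → EdgeColoring n → List (Fin n) → ℕ → Set
ColoredOn c P k = ∀ a b → (a , b) ∈ edges P → col c a b ≡ k

colors : ∀ {n} → EdgeColoring n → List (Fin n) → List ℕ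
colors c xs = map (uncurry (col c)) (edges xs)

count : ℕ → List ℕ → ℕ
count k ls = length (filter (_≟ k) ls)

ConflictFree : ∀ {n} → EdgeColoring n → List (Fin n) → Set
ConflictFree c xs = ∃[ k ] count k (colors c xs) ≡ 1

module Submission where

-- Write Eₖ for the edges of colour k.  Monochromatic
-- paths are easy: a path of Eₖ contains, between any two of its vertices,
-- a subpath of Eₖ ("segment"); apply this to the Hamilton path coloured k.
--
-- For a path using colour k exactly once, let L be the Hamilton path of the
-- other colour k' and M the Hamilton path of colour k.  Cutting L at u
-- splits the vertex set into two vertex-disjoint subpaths S ∋ u and T ∋ v
-- of colour k'.  M visits both sides, so one of its edges ab crosses from S
-- to T ("crossing edge").  The segment of S from u to a, the edge ab and
-- the segment of T from b to v form a path whose colours are k' … k' k k' … k';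
-- it uses colour k exactly once, hence is also conflict-free.

open import Defs hiding (sym)
open import Data.Nat using (ℕ) renaming (_≟_ to _≟ℕ_)
open import Data.Fin using (Fin; _≟_)
open import Data.List using (List; []; _∷_; _++_; [_]; map; filter; length; head; last; reverse)
open import Data.List.Properties
  using (unfold-reverse; reverse-involutive; map-++; filter-++; filter-none; filter-accept; ++-assoc)
open import Data.List.Relation.Unary.All as All using (All; []; _∷_)
import Data.List.Relation.Unary.All.Properties as All
open import Data.List.Relation.Unary.Any using (here; there)
import Data.List.Relation.Unary.Any.Properties as Any
open import Data.List.Relation.Unary.Unique.Propositional using (Unique; []; _∷_)
import Data.List.Relation.Unary.Unique.Propositional.Properties as Unique
open import Data.List.Membership.Propositional using (_∈_)
import Data.List.Membership.DecPropositional as DecMembership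
open import Data.List.Membership.Propositional.Properties using (∈-++⁺ʳ; ∈-++⁻; ∈-∃++)
open import Data.List.Relation.Binary.Subset.Propositional using (_⊆_)
open import Data.List.Relation.Binary.Disjoint.Propositional using (Disjoint)
import Data.List.Relation.Binary.Permutation.Setoid as Permutation
import Data.List.Relation.Binary.Permutation.Setoid.Properties as Permutation
open import Data.Product using (_×_; _,_; ∃-syntax; proj₁; proj₂; uncurry)
open import Data.Sum using (_⊎_; inj₁; inj₂; swap)
open import Data.Maybe using (just)
open import Data.Empty using (⊥-elim)
open import Relation.Nullary using (¬_; yes; no; ¬?)
open import Relation.Nullary.Decidable using (decidable-stable)
open import Relation.Unary using (Pred; Decidable)
open import Relation.Binary using (Rel; Symmetric; _⇒_)
open import Level using (0ℓ)
open import Relation.Binary.PropositionalEquality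
  using (_≡_; _≢_; refl; sym; trans; cong; subst; setoid; module ≡-Reasoning)

module _ {n : ℕ} where

  private
    V : Set
    V = Fin n

  head-++ : ∀ (xs ys : List V) {a} → head xs ≡ just a → head (xs ++ ys) ≡ just a
  head-++ (x ∷ xs) ys refl = refl

  last-++ : ∀ (xs ys : List V) {a} → last ys ≡ just a → last (xs ++ ys) ≡ just a
  last-++ []            ys       e = e
  last-++ (x ∷ [])      (y ∷ ys) e = e
  last-++ (x ∷ x′ ∷ xs) ys       e = last-++ (x′ ∷ xs) ys e

  last-reverse : ∀ (xs : List V) → last (reverse xs) ≡ head xs
  last-reverse []       = refl
  last-reverse (x ∷ xs) = trans (cong last (unfold-reverse x xs)) (last-++ (reverse xs) [ x ] refl)

  head-reverse : ∀ (xs : List V) → head (reverse xs) ≡ last xs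
  head-reverse xs = begin
    head (reverse xs)                     ≡⟨ sym (last-reverse (reverse xs)) ⟩
    last (reverse (reverse xs))           ≡⟨ cong last (reverse-involutive xs) ⟩
    last xs                               ∎
    where open ≡-Reasoning

  edges-++ : ∀ (xs ys : List V) {a b} → last xs ≡ just a → head ys ≡ just b →
             edges (xs ++ ys) ≡ edges xs ++ (a , b) ∷ edges ys
  edges-++ (x ∷ [])      (y ∷ ys) refl refl = refl
  edges-++ (x ∷ x′ ∷ xs) ys       la   hb   = cong ((x , x′) ∷_) (edges-++ (x′ ∷ xs) ys la hb)

  All-edges-++⁻ : ∀ {P : Pred (V × V) 0ℓ} (xs ys : List V) →
                  All P (edges (xs ++ ys)) → All P (edges xs) × All P (edges ys)
  All-edges-++⁻ []            ys       ps       = [] , ps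
  All-edges-++⁻ (x ∷ [])      []       ps       = [] , []
  All-edges-++⁻ (x ∷ [])      (y ∷ ys) (_ ∷ ps) = [] , ps
  All-edges-++⁻ (x ∷ x′ ∷ xs) ys       (p ∷ ps) =
    let qs , rs = All-edges-++⁻ (x′ ∷ xs) ys ps in p ∷ qs , rs

  All-edges-reverse : ∀ {R : Rel V 0ℓ} → Symmetric R → (xs : List V) →
                      All (uncurry R) (edges xs) → All (uncurry R) (edges (reverse xs))
  All-edges-reverse R-sym []           []       = []
  All-edges-reverse R-sym (x ∷ [])     []       = []
  All-edges-reverse {R} R-sym (x ∷ y ∷ ys) (r ∷ rs) =
    subst (All (uncurry R)) (sym edges-rev)
      (All.++⁺ (All-edges-reverse R-sym (y ∷ ys) rs) (R-sym r ∷ []))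
    where
    edges-rev : edges (reverse (x ∷ y ∷ ys)) ≡ edges (reverse (y ∷ ys)) ++ [ (y , x) ]
    edges-rev = trans (cong edges (unfold-reverse x (y ∷ ys)))
                      (edges-++ (reverse (y ∷ ys)) [ x ] (last-reverse (y ∷ ys)) refl)

  Unique-++⁻ : ∀ (xs ys : List V) → Unique (xs ++ ys) → Unique xs × Unique ys × Disjoint xs ys
  Unique-++⁻ []       ys u        = [] , u , λ ()
  Unique-++⁻ (x ∷ xs) ys (x∉ ∷ u) =
    let uxs , uys , xs#ys = Unique-++⁻ xs ys u
    in All.++⁻ˡ xs x∉ ∷ uxs , uys ,
       λ { (here refl , y∈ys) → All.lookup (All.++⁻ʳ xs x∉) y∈ys refl
         ; (there y∈xs , y∈ys) → xs#ys (y∈xs , y∈ys) }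

  IsPathIn : Rel V 0ℓ → List V → Set
  IsPathIn R xs = Unique xs × All (uncurry R) (edges xs)

  PathIn : Rel V 0ℓ → V → V → List V → Set
  PathIn R u v xs = IsPathIn R xs × head xs ≡ just u × last xs ≡ just v

  module _ {R : Rel V 0ℓ} where

    weaken : ∀ {S : Rel V 0ℓ} → R ⇒ S → ∀ {xs} → IsPathIn R xs → IsPathIn S xs
    weaken R⇒S (u , rs) = u , All.map R⇒S rs

    split : ∀ xs ys → IsPathIn R (xs ++ ys) → IsPathIn R xs × IsPathIn R ys × Disjoint xs ys
    split xs ys (u , rs) =
      let uxs , uys , disjoint = Unique-++⁻ xs ys u
          rxs , rys = All-edges-++⁻ xs ys rs
      in (uxs , rxs) , (uys , rys) , disjoint

    join : ∀ {u a b v xs ys} → PathIn R u a xs → PathIn R b v ys → R a b → Disjoint xs ys →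
           PathIn R u v (xs ++ ys)
    join {xs = xs} {ys} ((uxs , rxs) , hx , lx) ((uys , rys) , hy , ly) r disjoint =
      ( Unique.++⁺ uxs uys disjoint
      , subst (All (uncurry R)) (sym (edges-++ xs ys lx hy)) (All.++⁺ rxs (r ∷ rys)) )
      , head-++ xs ys hx , last-++ xs ys ly

    reverse-path : Symmetric R → ∀ {u v xs} → PathIn R u v xs → PathIn R v u (reverse xs)
    reverse-path R-sym {xs = xs} ((uxs , rxs) , hx , lx) =
      ( Permutation.Unique-resp-↭ (setoid V)
          (Permutation.↭-sym (setoid V) (Permutation.↭-reverse (setoid V) xs)) uxs
      , All-edges-reverse R-sym xs rxs )
      , trans (head-reverse xs) lx , trans (last-reverse xs) hx

    prefix : ∀ {t T v} → IsPathIn R (t ∷ T) → v ∈ t ∷ T → ∃[ zs ] PathIn R t v zs × zs ⊆ t ∷ T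
    prefix _ (here refl) = _ ∷ [] , (([] ∷ [] , []) , refl , refl) , λ { (here refl) → here refl }
    prefix {T = t′ ∷ T} (t∉ ∷ u , r ∷ rs) (there v∈)
      with prefix (u , rs) v∈
    ... | .t′ ∷ zs , ((uzs , rzs) , refl , lz) , zs⊆ =
      _ ∷ t′ ∷ zs , ((All.tabulate (λ p → All.lookup t∉ (zs⊆ p)) ∷ uzs , r ∷ rzs) , refl , lz)
      , λ { (here refl) → here refl ; (there p) → there (zs⊆ p) }

    segment : Symmetric R → ∀ {T y v} → IsPathIn R T → y ∈ T → v ∈ T → ∃[ zs ] PathIn R y v zs × zs ⊆ T
    segment R-sym p (here refl) v∈ = prefix p v∈
    segment R-sym p (there y∈) (here refl) =
      let zs , q , zs⊆ = prefix p (there y∈)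
      in reverse zs , reverse-path R-sym q , λ x∈ → zs⊆ (Any.reverse⁻ x∈)
    segment R-sym {t ∷ T} p (there y∈) (there v∈) =
      let zs , q , zs⊆ = segment R-sym (proj₁ (proj₂ (split [ t ] T p))) y∈ v∈
      in zs , q , λ x∈ → there (zs⊆ x∈)

    crossing-from : ∀ {P : Pred V 0ℓ} → Decidable P → ∀ {m M y} → All (uncurry R) (edges (m ∷ M)) →
                    P m → y ∈ m ∷ M → ¬ P y → ∃[ a ] ∃[ b ] R a b × P a × ¬ P b
    crossing-from P? _ pm (here refl) ¬py = ⊥-elim (¬py pm)
    crossing-from P? {m} {m′ ∷ M} (r ∷ rs) pm (there y∈) ¬py with P? m′
    ... | no ¬pm′ = m , m′ , r , pm , ¬pm′
    ... | yes pm′ = crossing-from P? rs pm′ y∈ ¬py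

    crossing : Symmetric R → ∀ {P : Pred V 0ℓ} → Decidable P → ∀ {M x y} →
               All (uncurry R) (edges M) → x ∈ M → y ∈ M → P x → ¬ P y →
               ∃[ a ] ∃[ b ] R a b × P a × ¬ P b
    crossing R-sym P? {m ∷ M} rs x∈ y∈ px ¬py with P? m
    ... | yes pm = crossing-from P? rs pm y∈ ¬py
    ... | no ¬pm =
      let a , b , r , ¬pa , ¬¬pb = crossing-from (λ z → ¬? (P? z)) rs ¬pm x∈ (λ ¬px → ¬px px)
      in b , a , R-sym r , decidable-stable (P? b) ¬¬pb , ¬pa

count-once : ∀ {k k′} → k′ ≢ k → ∀ {l₁ x l₂} → All (_≡ k′) l₁ → x ≡ k → All (_≡ k′) l₂ →
             count k (l₁ ++ x ∷ l₂) ≡ 1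
count-once {k} {k′} k′≢k {l₁} {x} {l₂} ps refl qs = begin
  length (filter (_≟ℕ k) (l₁ ++ k ∷ l₂))               ≡⟨ cong length (filter-++ (_≟ℕ k) l₁ (k ∷ l₂)) ⟩
  length (filter (_≟ℕ k) l₁ ++ filter (_≟ℕ k) (k ∷ l₂)) ≡⟨ cong (λ f → length (f ++ _)) (filter-none (_≟ℕ k) (other ps)) ⟩
  length (filter (_≟ℕ k) (k ∷ l₂))                     ≡⟨ cong length (filter-accept (_≟ℕ k) refl) ⟩
  length (k ∷ filter (_≟ℕ k) l₂)                       ≡⟨ cong (λ f → length (k ∷ f)) (filter-none (_≟ℕ k) (other qs)) ⟩
  1                                                   ∎
  where
  open ≡-Reasoning
  other : ∀ {l} → All (_≡ k′) l → All (λ y → ¬ y ≡ k) l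
  other = All.map λ y≡k′ y≡k → k′≢k (trans (sym y≡k′) y≡k)

module Coloured {n} (G : Graph n) (c : EdgeColoring n) where

  open DecMembership (_≟_ {n}) using (_∈?_)

  ColourEdge : ℕ → Rel (Fin n) 0ℓ
  ColourEdge k a b = Adj G a b × col c a b ≡ k

  colourEdge-sym : ∀ {k} → Symmetric (ColourEdge k)
  colourEdge-sym {x = a} {y = b} (adj , ab≡k) = Graph.sym G adj , trans (col-sym c b a) ab≡k

  hamilton-coloured : ∀ {P k} → HamiltonPath G P → ColoredOn c P k → IsPathIn (ColourEdge k) P
  hamilton-coloured ((u , adj) , _) coloured =
    u , All.tabulate λ { {a , b} e → All.lookup adj e , coloured a b e }

  forget-colour : ∀ {k u v xs} → PathIn (ColourEdge k) u v xs → PathBetween G u v xs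
  forget-colour (p , hx , lx) = weaken proj₁ p , hx , lx

  monochromatic : ∀ {k xs} → IsPathIn (ColourEdge k) xs → All (_≡ k) (colors c xs)
  monochromatic (_ , rs) = All.map⁺ (All.map proj₂ rs)

  monochromatic-path : ∀ {k P} → IsPathIn (ColourEdge k) P → (∀ x → x ∈ P) → ∀ u v →
                       ∃[ xs ] PathBetween G u v xs × All (_≡ k) (colors c xs)
  monochromatic-path p spanning u v =
    let xs , q , _ = segment colourEdge-sym p (spanning u) (spanning v)
    in xs , forget-colour q , monochromatic (proj₁ q)

  OnceColoured : ℕ → Fin n → Fin n → Set
  OnceColoured k u v = ∃[ xs ] PathBetween G u v xs × count k (colors c xs) ≡ 1

  colours-++ : ∀ xs ys {a b} → last xs ≡ just a → head ys ≡ just b →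
               colors c (xs ++ ys) ≡ colors c xs ++ col c a b ∷ colors c ys
  colours-++ xs ys la hb = begin
    map (uncurry (col c)) (edges (xs ++ ys))                   ≡⟨ cong (map (uncurry (col c))) (edges-++ xs ys la hb) ⟩
    map (uncurry (col c)) (edges xs ++ (_ , _) ∷ edges ys)     ≡⟨ map-++ (uncurry (col c)) (edges xs) _ ⟩
    colors c xs ++ col c _ _ ∷ colors c ys                     ∎
    where open ≡-Reasoning

  bridge : ∀ {k k′} → k′ ≢ k → ∀ {S T M u v} →
           IsPathIn (ColourEdge k′) S → IsPathIn (ColourEdge k′) T → Disjoint S T →
           (∀ x → x ∈ S ⊎ x ∈ T) → IsPathIn (ColourEdge k) M → (∀ x → x ∈ M) →
           u ∈ S → v ∈ T → OnceColoured k u v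
  bridge {k} k′≢k {S} {T} pS pT S#T cover (_ , edgesM) spanning u∈S v∈T =
    let a , b , (adj , ab≡k) , a∈S , b∉S =
          crossing colourEdge-sym (_∈? S) edgesM (spanning _) (spanning _) u∈S (λ v∈S → S#T (v∈S , v∈T))
        As , pathA@(pA , _ , lastA) , As⊆S = segment colourEdge-sym pS u∈S a∈S
        Bs , pathB@(pB , headB , _) , Bs⊆T = segment colourEdge-sym pT (outside-S b∉S) v∈T
    in As ++ Bs
     , join (forget-colour pathA) (forget-colour pathB) adj (λ (p , q) → S#T (As⊆S p , Bs⊆T q))
     , trans (cong (count k) (colours-++ As Bs lastA headB))
             (count-once k′≢k (monochromatic pA) ab≡k (monochromatic pB))
    where
    outside-S : ∀ {x} → ¬ x ∈ S → x ∈ T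
    outside-S {x} x∉S with cover x
    ... | inj₁ x∈S = ⊥-elim (x∉S x∈S)
    ... | inj₂ x∈T = x∈T

  -- Write L = ys ++ u ∷ zs;
  -- if v lies in ys, bridge from S = u ∷ zs to T = ys, otherwise from ys ++ [u] to zs.
  once-coloured-path : ∀ {k k′} → k′ ≢ k → ∀ {L M} →
                       IsPathIn (ColourEdge k′) L → (∀ x → x ∈ L) →
                       IsPathIn (ColourEdge k) M → (∀ x → x ∈ M) →
                       ∀ {u v} → u ≢ v → OnceColoured k u v
  once-coloured-path k′≢k pL spanningL pM spanningM {u} {v} u≢v
    with ys , zs , refl ← ∈-∃++ (spanningL u)
    with ∈-++⁻ ys (spanningL v)
  ... | inj₂ (here refl) = ⊥-elim (u≢v refl)
  ... | inj₁ v∈ys =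
    let pys , pzs , ys#zs = split ys (u ∷ zs) pL
        cover x = swap (∈-++⁻ ys (spanningL x))
    in bridge k′≢k pzs pys (λ (p , q) → ys#zs (q , p)) cover pM spanningM (here refl) v∈ys
  ... | inj₂ (there v∈zs) =
    let reassoc = sym (++-assoc ys [ u ] zs)
        pys , pzs , ys#zs = split (ys ++ [ u ]) zs (subst (IsPathIn _) reassoc pL)
        cover x = ∈-++⁻ (ys ++ [ u ]) (subst (x ∈_) reassoc (spanningL x))
    in bridge k′≢k pys pzs ys#zs cover pM spanningM (∈-++⁺ʳ ys (here refl)) v∈zs

lemma3p2 : ∀ {n} (G : Graph n) (c : EdgeColoring n) (P₁ P₂ : List (Fin n)) →
    HamiltonPath G P₁ → HamiltonPath G P₂ → EdgeDisjoint P₁ P₂ →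
    ColoredOn c P₁ 1 → ColoredOn c P₂ 2 →
    ∀ u v → u ≢ v →
      (∃[ xs ] PathBetween G u v xs × All (_≡ 1) (colors c xs))
      × (∃[ xs ] PathBetween G u v xs × All (_≡ 2) (colors c xs))
      × (∃[ xs ] PathBetween G u v xs × ConflictFree c xs × count 1 (colors c xs) ≡ 1)
      × (∃[ xs ] PathBetween G u v xs × ConflictFree c xs × count 2 (colors c xs) ≡ 1)
lemma3p2 G c P₁ P₂ ham₁ ham₂ _ coloured₁ coloured₂ u v u≢v =
  monochromatic-path p₁ (proj₂ ham₁) u v ,
  monochromatic-path p₂ (proj₂ ham₂) u v ,
  conflict-free (once-coloured-path (λ ()) p₂ (proj₂ ham₂) p₁ (proj₂ ham₁) u≢v) ,
  conflict-free (once-coloured-path (λ ()) p₁ (proj₂ ham₁) p₂ (proj₂ ham₂) u≢v)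
  where
  open Coloured G c
  p₁ = hamilton-coloured ham₁ coloured₁
  p₂ = hamilton-coloured ham₂ coloured₂

  conflict-free : ∀ {k} → OnceColoured k u v →
                  ∃[ xs ] PathBetween G u v xs × ConflictFree c xs × count k (colors c xs) ≡ 1
  conflict-free (xs , path , once) = xs , path , (_ , once) , once
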